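{- Let $b\ge2$ and $H\ge1$ be integers and let $\mathcal T$ be the balanced $b$-ary tree of depth $H$ (every non-leaf node has exactly $b$ children, all leaves at depth $H$). Under the negative feedback algorithm started at the root, $$\mathbb E_{\pi_{neg}}[T_C]\le 4H\,\frac{b+1}{b-1}\,b^H.$$
   Context: $T_C$ is the smallest $m$ such that $X_0,\dots,X_m$ visit all nodes of the tree. Negative feedback algorithm: for an edge from $i$ to $j$, let $N_{ij}^{(m)}$ be the number of times $t<m$ with $X_t=i,X_{t+1}=j$. Let $Smin_i^{(m)}$ be the set of neighbours $j$ of $i$ minimizing $N_{ij}^{(m)}$. If $X_m=i$, then given the past, $X_{m+1}$ is uniformly distributed on $Smin_i^{(m)}$. -}

module Defs where

open import Data.Nat using (ℕ; zero; suc; _⊓_; _<ᵇ_) renaming (_+_ to _+ₙ_; _≟_ to _≟ₙ_)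
open import Data.Bool using (Bool; true; false; if_then_else_; not; _∧_)
open import Data.Fin using (Fin)
open import Data.Fin.Properties using () renaming (_≟_ to _≟ᶠ_)
open import Data.List using (List; []; _∷_; _++_; map; concatMap; allFin; upTo; length; filter; foldr)
open import Data.Bool.ListAction using (all; any)
open import Data.List.Properties using (≡-dec)
open import Data.Product using (_×_; _,_; proj₁; proj₂)
open import Data.Integer using (+_)
open import Data.Rational using (ℚ; _/_; _*_; _+_; 0ℚ; 1ℚ)
open import Relation.Nullary.Decidable using (⌊_⌋)

-- A node is the word of child
-- indices on the path from the root, stored most-recent-choice first:
-- the root is [], the children of w are c ∷ w (c : Fin b), the parent
-- of c ∷ w is w.
module Tree (b H : ℕ) where

  Node : Set
  Node = List (Fin b)

  _==_ : Node → Node → Bool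
  v == w = ⌊ ≡-dec _≟ᶠ_ v w ⌋

  root : Node
  root = []

  wordsOfLen : ℕ → List Node
  wordsOfLen zero = [] ∷ []
  wordsOfLen (suc n) = concatMap (λ w → map (_∷ w) (allFin b)) (wordsOfLen n)

  allNodes : List Node
  allNodes = concatMap wordsOfLen (upTo (suc H))

  parents : Node → List Node
  parents [] = []
  parents (_ ∷ w) = w ∷ []

  children : Node → List Node
  children w = if length w <ᵇ H then map (_∷ w) (allFin b) else []

  neighbours : Node → List Node
  neighbours w = parents w ++ children w

  -- A trajectory X_0,…,X_m is stored reversed: X_m ∷ … ∷ X_0 ∷ [].
  -- N i j : number of t < m with X_t = i and X_{t+1} = j.
  N : Node → Node → List Node → ℕ
  N i j (y ∷ x ∷ rest) =
    (if (x == i) ∧ (y == j) then 1 else 0) +ₙ N i j (x ∷ rest)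
  N i j _ = 0

  head′ : List Node → Node
  head′ [] = root
  head′ (x ∷ _) = x

  Smin : List Node → List Node
  Smin [] = []
  Smin traj@(i ∷ _) =
    let ns = neighbours i
        mn = foldr (λ j acc → N i j traj ⊓ acc) (N i (head′ ns) traj) ns
    in filter (λ j → N i j traj ≟ₙ mn) ns

  -- Law of the trajectory: list of (reversed trajectory, probability).
  Dist : Set
  Dist = List (List Node × ℚ)

  step : List Node × ℚ → Dist
  step (traj , p) with Smin traj
  ... | [] = []
  ... | ss@(_ ∷ _) = map (λ j → (j ∷ traj) , p * ((+ 1) / length ss)) ss

  dist : ℕ → Dist
  dist zero = ((root ∷ []) , 1ℚ) ∷ []
  dist (suc m) = concatMap step (dist m)

  covered : List Node → Bool
  covered traj = all (λ v → any (v ==_) traj) allNodes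

  -- P(T_C > m) = P(X_0,…,X_m do not visit all nodes)
  tailProb : ℕ → ℚ
  tailProb m = foldr (λ tp acc → (if covered (proj₁ tp) then 0ℚ else proj₂ tp) + acc) 0ℚ (dist m)

  -- Σ_{m<M} P(T_C > m); E[T_C] = sup_M of this (tail-sum formula,
  -- which also accounts for any mass at T_C = ∞).
  partialExpectation : ℕ → ℚ
  partialExpectation zero = 0ℚ
  partialExpectation (suc M) = partialExpectation M + tailProb M

module Submission where

-- The negative feedback walk always leaves its current node along a least-used edge. On a
-- tree the crossings of an edge alternate in direction, so the walk has moved from x to a
-- neighbour w at most as often as from w back to x. Chaining these two facts along a path
-- shows that, while a node u is still unvisited, every edge out of a node at distance k from
-- u has been traversed at most k times. All distances are at most 2H, so a trajectory that
-- has not covered the tree has made at most 2H·E moves, E being the number of directed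
-- edges, and summing degrees level by level gives (b − 1)·E ≤ (b + 1)·b^H + (b − 1)·b^H.
-- Hence T_C ≤ 1 + 2H·E surely, which bounds every partial tail sum Σ_{m<M} P(T_C > m).

open import Defs
open import Data.Nat using (ℕ)

module ListSums where
  open import Data.Nat using (ℕ; zero; suc; _+_; _*_; _∸_; _^_; _≤_; _<_; z≤n)
  open import Data.Nat.Properties
  open import Data.List using (List; []; _∷_; _++_; _∷ʳ_; [_]; concatMap; length; upTo)
  open import Data.List.Properties using (upTo-∷ʳ; length-++)
  open import Data.List.Membership.Propositional using (_∈_)
  open import Data.List.Relation.Unary.Any using (here; there)
  open import Relation.Binary.PropositionalEquality using (_≡_; refl; sym; trans; cong; cong₂)

  private
    variable
      A B : Set

  sumOf : (A → ℕ) → List A → ℕ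
  sumOf f [] = 0
  sumOf f (x ∷ xs) = f x + sumOf f xs

  sumOf-cong : ∀ {f g : A → ℕ} xs → (∀ x → x ∈ xs → f x ≡ g x) → sumOf f xs ≡ sumOf g xs
  sumOf-cong [] _ = refl
  sumOf-cong (x ∷ xs) f≡g = cong₂ _+_ (f≡g x (here refl)) (sumOf-cong xs (λ y y∈ → f≡g y (there y∈)))

  sumOf-mono-≤ : ∀ {f g : A → ℕ} xs → (∀ x → x ∈ xs → f x ≤ g x) → sumOf f xs ≤ sumOf g xs
  sumOf-mono-≤ [] _ = z≤n
  sumOf-mono-≤ (x ∷ xs) f≤g = +-mono-≤ (f≤g x (here refl)) (sumOf-mono-≤ xs (λ y y∈ → f≤g y (there y∈)))

  sumOf-mono-< : ∀ {f g : A → ℕ} {z} xs → (∀ x → x ∈ xs → f x ≤ g x) → z ∈ xs → f z < g z →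
                 sumOf f xs < sumOf g xs
  sumOf-mono-< (x ∷ xs) f≤g (here refl) fz<gz =
    +-mono-<-≤ fz<gz (sumOf-mono-≤ xs (λ y y∈ → f≤g y (there y∈)))
  sumOf-mono-< (x ∷ xs) f≤g (there z∈) fz<gz =
    +-mono-≤-< (f≤g x (here refl)) (sumOf-mono-< xs (λ y y∈ → f≤g y (there y∈)) z∈ fz<gz)

  sumOf-const : ∀ c (xs : List A) → sumOf (λ _ → c) xs ≡ length xs * c
  sumOf-const c [] = refl
  sumOf-const c (x ∷ xs) = cong (c +_) (sumOf-const c xs)

  sumOf-++ : ∀ (f : A → ℕ) xs ys → sumOf f (xs ++ ys) ≡ sumOf f xs + sumOf f ys
  sumOf-++ f [] ys = refl
  sumOf-++ f (x ∷ xs) ys = trans (cong (f x +_) (sumOf-++ f xs ys)) (sym (+-assoc (f x) _ _))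

  sumOf-∷ʳ : ∀ (f : A → ℕ) xs x → sumOf f (xs ∷ʳ x) ≡ sumOf f xs + f x
  sumOf-∷ʳ f xs x = trans (sumOf-++ f xs [ x ]) (cong (sumOf f xs +_) (+-identityʳ (f x)))

  sumOf-concatMap : ∀ (f : B → ℕ) (g : A → List B) xs →
                    sumOf f (concatMap g xs) ≡ sumOf (λ x → sumOf f (g x)) xs
  sumOf-concatMap f g [] = refl
  sumOf-concatMap f g (x ∷ xs) =
    trans (sumOf-++ f (g x) (concatMap g xs)) (cong (sumOf f (g x) +_) (sumOf-concatMap f g xs))

  sumOf-*ʳ : ∀ (f : A → ℕ) c xs → sumOf (λ x → f x * c) xs ≡ sumOf f xs * c
  sumOf-*ʳ f c [] = refl
  sumOf-*ʳ f c (x ∷ xs) = trans (cong (f x * c +_) (sumOf-*ʳ f c xs)) (sym (*-distribʳ-+ c (f x) _))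

  geometric-sum-≤ : ∀ b n → (b ∸ 1) * sumOf (b ^_) (upTo n) ≤ b ^ n
  geometric-sum-≤ zero n = z≤n
  geometric-sum-≤ (suc c) zero = ≤-trans (≤-reflexive (*-zeroʳ c)) z≤n
  geometric-sum-≤ b@(suc c) (suc n) = begin
    c * sumOf (b ^_) (upTo (suc n))       ≡⟨ cong (λ ds → c * sumOf (b ^_) ds) (upTo-∷ʳ n) ⟨
    c * sumOf (b ^_) (upTo n ∷ʳ n)        ≡⟨ cong (c *_) (sumOf-∷ʳ (b ^_) (upTo n) n) ⟩
    c * (sumOf (b ^_) (upTo n) + b ^ n)   ≡⟨ *-distribˡ-+ c _ (b ^ n) ⟩
    c * sumOf (b ^_) (upTo n) + c * b ^ n ≤⟨ +-monoˡ-≤ (c * b ^ n) (geometric-sum-≤ b n) ⟩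
    b ^ n + c * b ^ n                     ≡⟨⟩
    b ^ suc n                             ∎
    where open ≤-Reasoning

  length-concatMap : ∀ (g : A → List B) xs → length (concatMap g xs) ≡ sumOf (λ x → length (g x)) xs
  length-concatMap g [] = refl
  length-concatMap g (x ∷ xs) = trans (length-++ (g x)) (cong (length (g x) +_) (length-concatMap g xs))

module NaturalsInRationals where
  open import Data.Nat as ℕ using (ℕ; suc; _≤_)
  open import Data.Integer as ℤ using (+_; +≤+)
  import Data.Integer.Properties as ℤ
  import Data.Nat.Properties as ℕ
  open import Data.Rational using (ℚ; _/_; _+_; _*_; 1ℚ; toℚᵘ) renaming (_≤_ to _≤ℚ_)
  open import Data.Rational.Properties
    using (toℚᵘ-injective; toℚᵘ-fromℚᵘ; toℚᵘ-homo-+; toℚᵘ-homo-*; toℚᵘ-cancel-≤)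
  open import Data.Rational.Unnormalised as ℚᵘ using (mkℚᵘ; *≡*; *≤*; _≃_)
  import Data.Rational.Unnormalised.Properties as ℚᵘ
  open import Relation.Binary.PropositionalEquality using (_≡_; sym; trans; cong)
  open ℚᵘ.≃-Reasoning

  fromℕ : ℕ → ℚ
  fromℕ n = + n / 1

  toℚᵘ-fromℕ : ∀ n → toℚᵘ (fromℕ n) ≃ mkℚᵘ (+ n) 0
  toℚᵘ-fromℕ n = toℚᵘ-fromℚᵘ (mkℚᵘ (+ n) 0)

  fromℕ-homo-+ : ∀ m n → fromℕ (m ℕ.+ n) ≡ fromℕ m + fromℕ n
  fromℕ-homo-+ m n = toℚᵘ-injective (begin
    toℚᵘ (fromℕ (m ℕ.+ n))               ≈⟨ toℚᵘ-fromℕ (m ℕ.+ n) ⟩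
    mkℚᵘ (+ (m ℕ.+ n)) 0                 ≈⟨ *≡* (cong (ℤ._* + 1) numerator) ⟩
    mkℚᵘ (+ m) 0 ℚᵘ.+ mkℚᵘ (+ n) 0       ≈⟨ ℚᵘ.+-cong (toℚᵘ-fromℕ m) (toℚᵘ-fromℕ n) ⟨
    toℚᵘ (fromℕ m) ℚᵘ.+ toℚᵘ (fromℕ n)   ≈⟨ toℚᵘ-homo-+ (fromℕ m) (fromℕ n) ⟨
    toℚᵘ (fromℕ m + fromℕ n)             ∎)
    where
    numerator : + (m ℕ.+ n) ≡ + m ℤ.* + 1 ℤ.+ + n ℤ.* + 1
    numerator rewrite ℤ.*-identityʳ (+ m) | ℤ.*-identityʳ (+ n) = ℤ.pos-+ m n

  fromℕ-homo-* : ∀ m n → fromℕ (m ℕ.* n) ≡ fromℕ m * fromℕ n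
  fromℕ-homo-* m n = toℚᵘ-injective (begin
    toℚᵘ (fromℕ (m ℕ.* n))               ≈⟨ toℚᵘ-fromℕ (m ℕ.* n) ⟩
    mkℚᵘ (+ (m ℕ.* n)) 0                 ≈⟨ *≡* (cong (ℤ._* + 1) (ℤ.pos-* m n)) ⟩
    mkℚᵘ (+ m) 0 ℚᵘ.* mkℚᵘ (+ n) 0       ≈⟨ ℚᵘ.*-cong (toℚᵘ-fromℕ m) (toℚᵘ-fromℕ n) ⟨
    toℚᵘ (fromℕ m) ℚᵘ.* toℚᵘ (fromℕ n)   ≈⟨ toℚᵘ-homo-* (fromℕ m) (fromℕ n) ⟨
    toℚᵘ (fromℕ m * fromℕ n)             ∎)

  fromℕ-*-inverse : ∀ n → fromℕ (suc n) * (+ 1 / suc n) ≡ 1ℚ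
  fromℕ-*-inverse n = toℚᵘ-injective (begin
    toℚᵘ (fromℕ (suc n) * (+ 1 / suc n))          ≈⟨ toℚᵘ-homo-* (fromℕ (suc n)) (+ 1 / suc n) ⟩
    toℚᵘ (fromℕ (suc n)) ℚᵘ.* toℚᵘ (+ 1 / suc n)
      ≈⟨ ℚᵘ.*-cong (toℚᵘ-fromℕ (suc n)) (toℚᵘ-fromℚᵘ (mkℚᵘ (+ 1) n)) ⟩
    mkℚᵘ (+ suc n) 0 ℚᵘ.* mkℚᵘ (+ 1) n            ≈⟨ *≡* numerator ⟩
    toℚᵘ 1ℚ                                        ∎)
    where
    numerator : (+ suc n ℤ.* + 1) ℤ.* + 1 ≡ + 1 ℤ.* + (1 ℕ.* suc n)
    numerator = trans (ℤ.*-identityʳ _) (trans (ℤ.*-identityʳ _)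
      (sym (trans (ℤ.*-identityˡ _) (cong +_ (ℕ.*-identityˡ (suc n))))))

  fromℕ-mono-≤ : ∀ {m n} → m ≤ n → fromℕ m ≤ℚ fromℕ n
  fromℕ-mono-≤ {m} {n} m≤n = toℚᵘ-cancel-≤ (ℚᵘ.≤-respˡ-≃ (ℚᵘ.≃-sym (toℚᵘ-fromℕ m))
    (ℚᵘ.≤-respʳ-≃ (ℚᵘ.≃-sym (toℚᵘ-fromℕ n)) (*≤* (ℤ.*-monoʳ-≤-nonNeg (+ 1) (+≤+ m≤n)))))

module Trajectories (b H : ℕ) where
  open Tree b H
  open ListSums
  open import Data.Nat using (ℕ; zero; suc; _+_; _*_; _∸_; _^_; _≤_; _<_; _<ᵇ_; _⊓_; z≤n; s≤s; s≤s⁻¹)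
  open import Data.Nat.Properties hiding (_≟_)
  open import Algebra.Properties.CommutativeSemigroup +-commutativeSemigroup using (x∙yz≈y∙xz; x∙yz≈yx∙z)
  open import Data.Bool using (true; false; T; if_then_else_)
  open import Data.Unit using (tt)
  open import Data.Fin.Properties using () renaming (_≟_ to _≟ᶠ_)
  open import Data.List using (List; []; _∷_; _++_; _∷ʳ_; map; allFin; upTo; length; foldr)
  open import Data.List.Properties using (≡-dec; length-map; length-tabulate; upTo-∷ʳ)
  open import Data.List.Membership.Propositional using (_∈_; _∉_; find; lose)
  open import Data.List.Membership.Propositional.Properties
    using (∈-map⁺; ∈-map⁻; ∈-++⁺ʳ; ∈-++⁻; ∈-allFin; ∈-filter⁻; ∈-concatMap⁺; ∈-concatMap⁻;
           ∈-upTo⁺; ∈-upTo⁻)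
  open import Data.List.Relation.Unary.Any using (here; there)
  import Data.List.Relation.Unary.Any as Any
  import Data.List.Relation.Unary.All as All
  open import Data.List.Relation.Unary.All.Properties using (all⁻)
  open import Data.List.Relation.Unary.Any.Properties using (any⁺)
  open import Data.Bool.ListAction using (any)
  open import Data.Product using (_×_; _,_; proj₁; proj₂; ∃-syntax)
  open import Data.Sum using (_⊎_; inj₁; inj₂)
  open import Function using (_∘_)
  open import Data.Empty using (⊥-elim)
  open import Relation.Nullary using (Dec; yes; no; does; ¬_; _×-dec_)
  open import Relation.Nullary.Decidable using (dec-true; dec-false; fromWitness)
  open import Relation.Binary.Definitions using (DecidableEquality)
  open import Relation.Binary.PropositionalEquality
    using (_≡_; _≢_; refl; sym; trans; cong; cong₂; subst; module ≡-Reasoning)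

  infix 4 _≟_
  _≟_ : DecidableEquality Node
  _≟_ = ≡-dec _≟ᶠ_

  open import Data.List.Membership.DecPropositional _≟_ using (_∈?_)

  𝟙[_] : {P : Set} → Dec P → ℕ
  𝟙[ P? ] = if does P? then 1 else 0

  𝟙-yes : {P : Set} (P? : Dec P) → P → 𝟙[ P? ] ≡ 1
  𝟙-yes P? p = cong (if_then 1 else 0) (dec-true P? p)

  𝟙-no : {P : Set} (P? : Dec P) → ¬ P → 𝟙[ P? ] ≡ 0
  𝟙-no P? ¬p = cong (if_then 1 else 0) (dec-false P? ¬p)

  ∈-children⁻ : ∀ {x y} → y ∈ children x → ∃[ a ] (y ≡ a ∷ x × length x < H)
  ∈-children⁻ {x} y∈ with length x <ᵇ H in leaf?
  ... | true with ∈-map⁻ (_∷ x) y∈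
  ...   | a , _ , refl = a , refl , <ᵇ⇒< (length x) H (subst T (sym leaf?) tt)

  ∈-neighbours⁻ : ∀ {x y} → y ∈ neighbours x →
    (∃[ a ] x ≡ a ∷ y) ⊎ (∃[ a ] (y ≡ a ∷ x × length x < H))
  ∈-neighbours⁻ {x} y∈ with ∈-++⁻ (parents x) y∈
  ∈-neighbours⁻ {a ∷ x} _ | inj₁ (here refl) = inj₁ (a , refl)
  ... | inj₂ y∈children = inj₂ (∈-children⁻ y∈children)

  parent∈neighbours : ∀ a (x : Node) → x ∈ neighbours (a ∷ x)
  parent∈neighbours a x = here refl

  child∈neighbours : ∀ a {x} → length x < H → (a ∷ x) ∈ neighbours x
  child∈neighbours a {x} x<H = ∈-++⁺ʳ (parents x) a∷x∈children
    where
    a∷x∈children : (a ∷ x) ∈ children x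
    a∷x∈children with length x <ᵇ H in leaf?
    ... | true = ∈-map⁺ (_∷ x) (∈-allFin a)
    ... | false = ⊥-elim (subst T leaf? (<⇒<ᵇ x<H))

  neighbour-depth-≤ : ∀ {x y} → y ∈ neighbours x → length x ≤ H → length y ≤ H
  neighbour-depth-≤ y∈ x≤H with ∈-neighbours⁻ y∈
  ... | inj₁ (_ , refl) = <⇒≤ x≤H
  ... | inj₂ (_ , refl , x<H) = x<H

  ∈-wordsOfLen : ∀ v → v ∈ wordsOfLen (length v)
  ∈-wordsOfLen [] = here refl
  ∈-wordsOfLen (a ∷ v) =
    ∈-concatMap⁺ (λ w → map (_∷ w) (allFin b)) (lose (∈-wordsOfLen v) (∈-map⁺ (_∷ v) (∈-allFin a)))

  wordsOfLen-length : ∀ n {v} → v ∈ wordsOfLen n → length v ≡ n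
  wordsOfLen-length zero (here refl) = refl
  wordsOfLen-length (suc n) v∈ with find (∈-concatMap⁻ (λ w → map (_∷ w) (allFin b)) {xs = wordsOfLen n} v∈)
  ... | w , w∈ , v∈ws with ∈-map⁻ (_∷ w) v∈ws
  ...   | _ , _ , refl = cong suc (wordsOfLen-length n w∈)

  ∈-allNodes⁺ : ∀ {v} → length v ≤ H → v ∈ allNodes
  ∈-allNodes⁺ {v} v≤H = ∈-concatMap⁺ wordsOfLen (lose (∈-upTo⁺ (s≤s v≤H)) (∈-wordsOfLen v))

  ∈-allNodes⁻ : ∀ {v} → v ∈ allNodes → length v ≤ H
  ∈-allNodes⁻ v∈ with find (∈-concatMap⁻ wordsOfLen {xs = upTo (suc H)} v∈)
  ... | n , n∈ , v∈ws = subst (_≤ H) (sym (wordsOfLen-length n v∈ws)) (s≤s⁻¹ (∈-upTo⁻ n∈))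

  N-step : ∀ i j x y r → N i j (y ∷ x ∷ r) ≡ 𝟙[ x ≟ i ×-dec y ≟ j ] + N i j (x ∷ r)
  N-step i j x y r with x ≟ i | y ≟ j
  ... | yes _ | yes _ = refl
  ... | yes _ | no _ = refl
  ... | no _ | _ = refl

  N-step-hit : ∀ x y r → N x y (y ∷ x ∷ r) ≡ suc (N x y (x ∷ r))
  N-step-hit x y r = trans (N-step x y x y r) (cong (_+ N x y (x ∷ r)) (𝟙-yes (x ≟ x ×-dec y ≟ y) (refl , refl)))

  N-step-miss : ∀ {i j x y} r → ¬ (x ≡ i × y ≡ j) → N i j (y ∷ x ∷ r) ≡ N i j (x ∷ r)
  N-step-miss {i} {j} {x} {y} r ¬hit =
    trans (N-step i j x y r) (cong (_+ N i j (x ∷ r)) (𝟙-no (x ≟ i ×-dec y ≟ j) ¬hit))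

  N-step-≤ : ∀ i j x y r → N i j (x ∷ r) ≤ N i j (y ∷ x ∷ r)
  N-step-≤ i j x y r = subst (N i j (x ∷ r) ≤_) (sym (N-step i j x y r)) (m≤n+m _ _)

  foldr-⊓-≤ : ∀ (f : Node → ℕ) z {w} xs → w ∈ xs → foldr (λ j acc → f j ⊓ acc) z xs ≤ f w
  foldr-⊓-≤ f z (x ∷ xs) (here refl) = m⊓n≤m (f x) _
  foldr-⊓-≤ f z (x ∷ xs) (there w∈) = ≤-trans (m⊓n≤n (f x) _) (foldr-⊓-≤ f z xs w∈)

  minCount : Node → List Node → ℕ
  minCount x t = foldr (λ j acc → N x j t ⊓ acc) (N x (head′ (neighbours x)) t) (neighbours x)

  ∈-Smin⁻ : ∀ {x r y} → y ∈ Smin (x ∷ r) → y ∈ neighbours x × N x y (x ∷ r) ≡ minCount x (x ∷ r)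
  ∈-Smin⁻ {x} {r} = ∈-filter⁻ (λ j → N x j (x ∷ r) Data.Nat.≟ minCount x (x ∷ r))

  Smin⊆neighbours : ∀ {x r y} → y ∈ Smin (x ∷ r) → y ∈ neighbours x
  Smin⊆neighbours {x} {r} y∈ = proj₁ (∈-Smin⁻ {x} {r} y∈)

  Smin-minimal : ∀ {x r y w} → y ∈ Smin (x ∷ r) → w ∈ neighbours x → N x y (x ∷ r) ≤ N x w (x ∷ r)
  Smin-minimal {x} {r} y∈ w∈ =
    subst (_≤ _) (sym (proj₂ (∈-Smin⁻ {x} {r} y∈))) (foldr-⊓-≤ (λ j → N x j (x ∷ r)) _ _ w∈)

  data Reachable : List Node → Set where
    start : Reachable (root ∷ [])
    move : ∀ {x r y} → Reachable (x ∷ r) → y ∈ Smin (x ∷ r) → Reachable (y ∷ x ∷ r)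

  Reachable-extend : ∀ {t y} → Reachable t → y ∈ Smin t → Reachable (y ∷ t)
  Reachable-extend start y∈ = move start y∈
  Reachable-extend R@(move _ _) y∈ = move R y∈

  Reachable-depth : ∀ {x r} → Reachable (x ∷ r) → length x ≤ H
  Reachable-depth start = z≤n
  Reachable-depth (move {x} {r} R y∈) = neighbour-depth-≤ (Smin⊆neighbours {x} {r} y∈) (Reachable-depth R)

  -- Nodes are stored leaf-first, so v lies in the subtree rooted at c iff c is a suffix of v.
  inSubtree : Node → Node → ℕ
  inSubtree c [] = 𝟙[ c ≟ [] ]
  inSubtree c (a ∷ v) with c ≟ a ∷ v
  ... | yes _ = 1
  ... | no _ = inSubtree c v

  inSubtree-self : ∀ c → inSubtree c c ≡ 1
  inSubtree-self [] = refl
  inSubtree-self (a ∷ v) with (a ∷ v) ≟ (a ∷ v)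
  ... | yes _ = refl
  ... | no c≢c = ⊥-elim (c≢c refl)

  inSubtree-shallow : ∀ c v → length v < length c → inSubtree c v ≡ 0
  inSubtree-shallow c [] v<c with c ≟ []
  ... | yes refl = ⊥-elim (n≮0 v<c)
  ... | no _ = refl
  inSubtree-shallow c (a ∷ v) v<c with c ≟ a ∷ v
  ... | yes refl = ⊥-elim (<-irrefl refl v<c)
  ... | no _ = inSubtree-shallow c v (<-trans (n<1+n _) v<c)

  inSubtree-parent : ∀ {c} a v → c ≢ a ∷ v → inSubtree c (a ∷ v) ≡ inSubtree c v
  inSubtree-parent {c} a v c≢ with c ≟ a ∷ v
  ... | yes c≡ = ⊥-elim (c≢ c≡)
  ... | no _ = refl

  inSubtree-adjacent : ∀ {a p x y} → y ∈ neighbours x →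
    ¬ (x ≡ p × y ≡ a ∷ p) → ¬ (x ≡ a ∷ p × y ≡ p) → inSubtree (a ∷ p) x ≡ inSubtree (a ∷ p) y
  inSubtree-adjacent {a} {p} {x} {y} y∈ ¬enter ¬leave with ∈-neighbours⁻ y∈
  ... | inj₁ (e , refl) = inSubtree-parent e y λ { refl → ¬leave (refl , refl) }
  ... | inj₂ (e , refl , _) = sym (inSubtree-parent e x λ { refl → ¬enter (refl , refl) })

  inSubtree-step : ∀ {a p x y} → y ∈ neighbours x →
    (enter? : Dec (x ≡ p × y ≡ a ∷ p)) (leave? : Dec (x ≡ a ∷ p × y ≡ p)) →
    𝟙[ enter? ] + inSubtree (a ∷ p) x ≡ 𝟙[ leave? ] + inSubtree (a ∷ p) y
  inSubtree-step _ (yes (refl , refl)) (yes (() , _))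
  inSubtree-step {a} {x = x} _ (yes (refl , refl)) (no _) =
    trans (cong suc (inSubtree-shallow (a ∷ x) x (n<1+n _))) (sym (inSubtree-self (a ∷ x)))
  inSubtree-step {a} {y = y} _ (no _) (yes (refl , refl)) =
    trans (inSubtree-self (a ∷ y)) (cong suc (sym (inSubtree-shallow (a ∷ y) y (n<1+n _))))
  inSubtree-step y∈ (no ¬enter) (no ¬leave) = inSubtree-adjacent y∈ ¬enter ¬leave

  -- Crossings of the edge between p and a ∷ p alternate in direction, so the downward ones
  -- exceed the upward ones by one exactly while the walk is inside the subtree of a ∷ p.
  crossings-balance : ∀ {t} → Reachable t → ∀ a p →
    N p (a ∷ p) t ≡ N (a ∷ p) p t + inSubtree (a ∷ p) (head′ t)
  crossings-balance start a p = refl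
  crossings-balance (move {x} {r} {y} R y∈) a p = begin
    N p c (y ∷ x ∷ r)                     ≡⟨ N-step p c x y r ⟩
    𝟙[ enter? ] + N p c (x ∷ r)           ≡⟨ cong (𝟙[ enter? ] +_) (crossings-balance R a p) ⟩
    𝟙[ enter? ] + (N c p (x ∷ r) + inSubtree c x) ≡⟨ x∙yz≈y∙xz 𝟙[ enter? ] (N c p (x ∷ r)) _ ⟩
    N c p (x ∷ r) + (𝟙[ enter? ] + inSubtree c x) ≡⟨ cong (N c p (x ∷ r) +_) (inSubtree-step y∈′ enter? leave?) ⟩
    N c p (x ∷ r) + (𝟙[ leave? ] + inSubtree c y) ≡⟨ x∙yz≈yx∙z (N c p (x ∷ r)) 𝟙[ leave? ] _ ⟩
    𝟙[ leave? ] + N c p (x ∷ r) + inSubtree c y   ≡⟨ cong (_+ inSubtree c y) (N-step c p x y r) ⟨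
    N c p (y ∷ x ∷ r) + inSubtree c y     ∎
    where
    open ≡-Reasoning
    c : Node
    c = a ∷ p
    enter? : Dec (x ≡ p × y ≡ c)
    enter? = x ≟ p ×-dec y ≟ c
    leave? : Dec (x ≡ c × y ≡ p)
    leave? = x ≟ c ×-dec y ≟ p
    y∈′ : y ∈ neighbours x
    y∈′ = Smin⊆neighbours {x} {r} y∈

  N-out≤N-in : ∀ {x r w} → Reachable (x ∷ r) → w ∈ neighbours x → N x w (x ∷ r) ≤ N w x (x ∷ r)
  N-out≤N-in {x} {r} {w} R w∈ with ∈-neighbours⁻ w∈
  ... | inj₁ (a , refl) = subst (N x w (x ∷ r) ≤_) (sym into-x) (m≤m+n _ 1)
    where
    into-x : N w x (x ∷ r) ≡ N x w (x ∷ r) + 1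
    into-x = trans (crossings-balance R a w) (cong (N x w (x ∷ r) +_) (inSubtree-self x))
  ... | inj₂ (a , refl , _) = ≤-reflexive (begin
    N x w (x ∷ r)                        ≡⟨ crossings-balance R a x ⟩
    N w x (x ∷ r) + inSubtree w x        ≡⟨ cong (N w x (x ∷ r) +_) (inSubtree-shallow w x (n<1+n _)) ⟩
    N w x (x ∷ r) + 0                    ≡⟨ +-identityʳ _ ⟩
    N w x (x ∷ r)                        ∎)
    where open ≡-Reasoning

  data Within : ℕ → Node → Node → Set where
    stay : ∀ {k u} → Within k u u
    hop : ∀ {k i w u} → w ∈ neighbours i → Within k w u → Within (suc k) i u

  Within-snoc : ∀ {k i u w} → Within k i u → w ∈ neighbours u → Within (suc k) i w
  Within-snoc stay w∈ = hop w∈ stay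
  Within-snoc (hop v∈ W) w∈ = hop v∈ (Within-snoc W w∈)

  root-Within : ∀ u → length u ≤ H → Within (length u) root u
  root-Within [] _ = stay
  root-Within (a ∷ v) a∷v≤H = Within-snoc (root-Within v (<⇒≤ a∷v≤H)) (child∈neighbours a a∷v≤H)

  Within-via-root : ∀ i {k u} → Within k root u → Within (length i + k) i u
  Within-via-root [] W = W
  Within-via-root (a ∷ v) W = hop (parent∈neighbours a v) (Within-via-root v W)

  -- If the walk moves from x to y and w is the next node on a path to the unvisited node,
  -- then N x y ≤ N x w ≤ N w x, and the last count is bounded by induction.
  N≤distance-to-unvisited : ∀ {t u k i} → Reachable t → u ∉ t → Within k i u → ∀ j → N i j t ≤ k
  N≤distance-to-unvisited start _ _ _ = z≤n
  N≤distance-to-unvisited {i = i} (move {x} {r} {y} R y∈) u∉ W j with x ≟ i ×-dec y ≟ j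
  N≤distance-to-unvisited (move R y∈) u∉ stay _ | yes (refl , refl) = ⊥-elim (u∉ (there (here refl)))
  N≤distance-to-unvisited {k = suc k} (move {x} {r} {y} R y∈) u∉ (hop {w = w} w∈ W) _ | yes (refl , refl) =
    subst (_≤ suc k) (sym (N-step-hit x y r)) (s≤s (begin
      N x y (x ∷ r)  ≤⟨ Smin-minimal {x} {r} y∈ w∈ ⟩
      N x w (x ∷ r)  ≤⟨ N-out≤N-in R w∈ ⟩
      N w x (x ∷ r)  ≤⟨ N≤distance-to-unvisited R (λ u∈ → u∉ (there u∈)) W x ⟩
      k              ∎))
    where open ≤-Reasoning
  N≤distance-to-unvisited (move {x} {r} {y} R y∈) u∉ W j | no ¬hit =
    subst (_≤ _) (sym (N-step-miss r ¬hit)) (N≤distance-to-unvisited R (λ u∈ → u∉ (there u∈)) W j)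

  traversals : List Node → ℕ
  traversals t = sumOf (λ i → sumOf (λ j → N i j t) (neighbours i)) allNodes

  traversals-step : ∀ {x y} r → length x ≤ H → y ∈ neighbours x → traversals (x ∷ r) < traversals (y ∷ x ∷ r)
  traversals-step {x} {y} r x≤H y∈ =
    sumOf-mono-< {z = x} allNodes (λ i _ → sumOf-mono-≤ (neighbours i) (λ j _ → N-step-≤ i j x y r))
      (∈-allNodes⁺ x≤H)
      (sumOf-mono-< (neighbours x) (λ j _ → N-step-≤ x j x y r) y∈ (≤-reflexive (sym (N-step-hit x y r))))

  length≤suc-traversals : ∀ {t} → Reachable t → length t ≤ suc (traversals t)
  length≤suc-traversals start = s≤s z≤n
  length≤suc-traversals (move {x} {r} R y∈) =
    s≤s (≤-trans (length≤suc-traversals R) (traversals-step r (Reachable-depth R) (Smin⊆neighbours {x} {r} y∈)))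

  degreeSum : ℕ
  degreeSum = sumOf (λ i → length (neighbours i)) allNodes

  traversals-while-unvisited : ∀ {t u} → Reachable t → u ∈ allNodes → u ∉ t → traversals t ≤ degreeSum * (H + H)
  traversals-while-unvisited {t} {u} R u∈ u∉ = begin
    traversals t                                           ≤⟨ sumOf-mono-≤ allNodes per-node ⟩
    sumOf (λ i → length (neighbours i) * (H + H)) allNodes ≡⟨ sumOf-*ʳ (length ∘ neighbours) (H + H) allNodes ⟩
    degreeSum * (H + H)                                    ∎
    where
    open ≤-Reasoning
    per-edge : ∀ {i} → i ∈ allNodes → ∀ j → N i j t ≤ H + H
    per-edge {i} i∈ j = ≤-trans
      (N≤distance-to-unvisited R u∉ (Within-via-root i (root-Within u (∈-allNodes⁻ u∈))) j)
      (+-mono-≤ (∈-allNodes⁻ i∈) (∈-allNodes⁻ u∈))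
    per-node : ∀ i → i ∈ allNodes → sumOf (λ j → N i j t) (neighbours i) ≤ length (neighbours i) * (H + H)
    per-node i i∈ = ≤-trans (sumOf-mono-≤ (neighbours i) (λ j _ → per-edge i∈ j))
                            (≤-reflexive (sumOf-const (H + H) (neighbours i)))

  coverBound : ℕ
  coverBound = suc (degreeSum * (H + H))

  covered-after-coverBound : ∀ {t} → Reachable t → coverBound < length t → T (covered t)
  covered-after-coverBound {t} R long = all⁻ (λ v → any (v ==_) t) (All.tabulate visited)
    where
    visited : ∀ {u} → u ∈ allNodes → T (any (u ==_) t)
    visited {u} u∈ with u ∈? t
    ... | yes u∈t = any⁺ (u ==_) (Any.map fromWitness u∈t)
    ... | no u∉t = ⊥-elim (≤⇒≯ short long)
      where
      short : length t ≤ coverBound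
      short = ≤-trans (length≤suc-traversals R) (s≤s (traversals-while-unvisited R u∈ u∉t))

  ∈-step⁻ : ∀ {t p z} → z ∈ step (t , p) → ∃[ y ] (y ∈ Smin t × proj₁ z ≡ y ∷ t)
  ∈-step⁻ {t} z∈ with Smin t
  ... | _ ∷ _ with ∈-map⁻ _ z∈
  ...   | y , y∈ , refl = y , y∈ , refl

  dist-Reachable : ∀ m {z} → z ∈ dist m → Reachable (proj₁ z) × length (proj₁ z) ≡ suc m
  dist-Reachable zero (here refl) = start , refl
  dist-Reachable (suc m) z∈ with find (∈-concatMap⁻ step {xs = dist m} z∈)
  ... | (t , p) , tp∈ , z∈step with ∈-step⁻ {t} {p} z∈step | dist-Reachable m tp∈
  ...   | y , y∈ , z≡y∷t | R , length≡ =
    subst (λ t′ → Reachable t′ × length t′ ≡ suc (suc m)) (sym z≡y∷t)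
          (Reachable-extend R y∈ , cong suc length≡)

  dist-covered : ∀ {m z} → coverBound ≤ m → z ∈ dist m → T (covered (proj₁ z))
  dist-covered {m} bound≤m z∈ with dist-Reachable m z∈
  ... | R , length≡ = covered-after-coverBound R (subst (coverBound <_) (sym length≡) (s≤s bound≤m))

  length-allFin : length (allFin b) ≡ b
  length-allFin = length-tabulate (λ a → a)

  childCount : ℕ → ℕ
  childCount d = if d <ᵇ H then b else 0

  length-children : ∀ w → length (children w) ≡ childCount (length w)
  length-children w with length w <ᵇ H
  ... | true = trans (length-map (_∷ w) (allFin b)) length-allFin
  ... | false = refl

  degree-≤ : ∀ w → length (neighbours w) ≤ suc (childCount (length w))
  degree-≤ [] = ≤-trans (≤-reflexive (length-children [])) (n≤1+n _)
  degree-≤ (a ∷ w) = s≤s (≤-reflexive (length-children (a ∷ w)))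

  childCount-internal : ∀ {d} → d < H → childCount d ≡ b
  childCount-internal {d} d<H with d <ᵇ H in internal?
  ... | true = refl
  ... | false = ⊥-elim (subst T internal? (<⇒<ᵇ d<H))

  childCount-leaves : childCount H ≡ 0
  childCount-leaves with H <ᵇ H in leaf?
  ... | true = ⊥-elim (<-irrefl refl (<ᵇ⇒< H H (subst T (sym leaf?) tt)))
  ... | false = refl

  length-wordsOfLen : ∀ n → length (wordsOfLen n) ≡ b ^ n
  length-wordsOfLen zero = refl
  length-wordsOfLen (suc n) = begin
    length (wordsOfLen (suc n))                        ≡⟨ length-concatMap extend (wordsOfLen n) ⟩
    sumOf (λ w → length (extend w)) (wordsOfLen n)     ≡⟨ sumOf-cong (wordsOfLen n) (λ w _ → length-extend w) ⟩
    sumOf (λ _ → b) (wordsOfLen n)                     ≡⟨ sumOf-const b (wordsOfLen n) ⟩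
    length (wordsOfLen n) * b                          ≡⟨ cong (_* b) (length-wordsOfLen n) ⟩
    b ^ n * b                                          ≡⟨ *-comm (b ^ n) b ⟩
    b ^ suc n                                          ∎
    where
    open ≡-Reasoning
    extend : Node → List Node
    extend w = map (_∷ w) (allFin b)
    length-extend : ∀ w → length (extend w) ≡ b
    length-extend w = trans (length-map (_∷ w) (allFin b)) length-allFin

  sumOf-allNodes-by-depth : ∀ (f : ℕ → ℕ) →
    sumOf (λ w → f (length w)) allNodes ≡ sumOf (λ d → b ^ d * f d) (upTo (suc H))
  sumOf-allNodes-by-depth f =
    trans (sumOf-concatMap (λ w → f (length w)) wordsOfLen (upTo (suc H)))
          (sumOf-cong (upTo (suc H)) (λ d _ → per-depth d))
    where
    per-depth : ∀ d → sumOf (λ w → f (length w)) (wordsOfLen d) ≡ b ^ d * f d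
    per-depth d = begin
      sumOf (λ w → f (length w)) (wordsOfLen d)
        ≡⟨ sumOf-cong (wordsOfLen d) (λ w w∈ → cong f (wordsOfLen-length d w∈)) ⟩
      sumOf (λ _ → f d) (wordsOfLen d)          ≡⟨ sumOf-const (f d) (wordsOfLen d) ⟩
      length (wordsOfLen d) * f d               ≡⟨ cong (_* f d) (length-wordsOfLen d) ⟩
      b ^ d * f d                               ∎
      where open ≡-Reasoning

  degreeSum-≤ : degreeSum ≤ sumOf (b ^_) (upTo H) * suc b + b ^ H
  degreeSum-≤ = begin
    degreeSum                                                  ≤⟨ sumOf-mono-≤ allNodes (λ w _ → degree-≤ w) ⟩
    sumOf (λ w → suc (childCount (length w))) allNodes         ≡⟨ sumOf-allNodes-by-depth (λ d → suc (childCount d)) ⟩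
    sumOf weight (upTo (suc H))                                ≡⟨ cong (sumOf weight) (upTo-∷ʳ H) ⟨
    sumOf weight (upTo H ∷ʳ H)                                 ≡⟨ sumOf-∷ʳ weight (upTo H) H ⟩
    sumOf weight (upTo H) + weight H                           ≡⟨ cong₂ _+_ (sumOf-cong (upTo H) internal) leaves ⟩
    sumOf (λ d → b ^ d * suc b) (upTo H) + b ^ H               ≡⟨ cong (_+ b ^ H) (sumOf-*ʳ (b ^_) (suc b) (upTo H)) ⟩
    sumOf (b ^_) (upTo H) * suc b + b ^ H                      ∎
    where
    open ≤-Reasoning
    weight : ℕ → ℕ
    weight d = b ^ d * suc (childCount d)
    internal : ∀ d → d ∈ upTo H → weight d ≡ b ^ d * suc b
    internal d d∈ = cong (λ k → b ^ d * suc k) (childCount-internal (∈-upTo⁻ d∈))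
    leaves : weight H ≡ b ^ H
    leaves = trans (cong (λ k → b ^ H * suc k) childCount-leaves) (*-identityʳ (b ^ H))

  degreeSum-bound : (b ∸ 1) * degreeSum ≤ b ^ H * suc b + (b ∸ 1) * b ^ H
  degreeSum-bound = begin
    (b ∸ 1) * degreeSum                                   ≤⟨ *-monoʳ-≤ (b ∸ 1) degreeSum-≤ ⟩
    (b ∸ 1) * (G * suc b + b ^ H)                         ≡⟨ *-distribˡ-+ (b ∸ 1) (G * suc b) (b ^ H) ⟩
    (b ∸ 1) * (G * suc b) + (b ∸ 1) * b ^ H               ≡⟨ cong (_+ (b ∸ 1) * b ^ H) (*-assoc (b ∸ 1) G (suc b)) ⟨
    (b ∸ 1) * G * suc b + (b ∸ 1) * b ^ H                 ≤⟨ +-monoˡ-≤ _ (*-monoˡ-≤ (suc b) (geometric-sum-≤ b H)) ⟩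
    b ^ H * suc b + (b ∸ 1) * b ^ H                       ∎
    where
    open ≤-Reasoning
    G : ℕ
    G = sumOf (b ^_) (upTo H)

module TailSums (b H : ℕ) where
  open Tree b H
  open Trajectories b H using (coverBound; dist-covered)
  open NaturalsInRationals
  open import Data.Nat as ℕ using (zero; suc; _∸_; _≤?_)
  import Data.Nat.Properties as ℕ
  open import Data.Bool using (true; false; T; if_then_else_)
  import Data.Integer as ℤ
  open import Data.Rational using (ℚ; _/_; _+_; _*_; 0ℚ; 1ℚ; _≤_; nonNegative)
  open import Data.Rational.Properties
    using (≤-refl; ≤-trans; ≤-reflexive; +-mono-≤; +-assoc; +-identityˡ; +-identityʳ; *-identityˡ; *-zeroˡ;
           *-comm; *-assoc; *-distribʳ-+; nonNegative⁻¹; nonNeg*nonNeg⇒nonNeg; normalize-nonNeg)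
  open import Data.List using (List; []; _∷_; _++_; map; length; foldr; concatMap)
  open import Data.List.Relation.Unary.All as All using (All; []; _∷_)
  open import Data.List.Relation.Unary.All.Properties using (++⁺; map⁺)
  open import Data.Product using (_,_; proj₁; proj₂)
  open import Relation.Nullary using (yes; no)
  open import Relation.Binary.PropositionalEquality using (_≡_; refl; sym; trans; cong; module ≡-Reasoning)

  mass : Dist → ℚ
  mass = foldr (λ tp acc → proj₂ tp + acc) 0ℚ

  -- tailProb m unfolds to uncoveredMass (dist m).
  uncoveredMass : Dist → ℚ
  uncoveredMass = foldr (λ tp acc → (if covered (proj₁ tp) then 0ℚ else proj₂ tp) + acc) 0ℚ

  NonNegative : Dist → Set
  NonNegative = All (λ tp → 0ℚ ≤ proj₂ tp)

  mass-++ : ∀ xs ys → mass (xs ++ ys) ≡ mass xs + mass ys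
  mass-++ [] ys = sym (+-identityˡ (mass ys))
  mass-++ (x ∷ xs) ys = trans (cong (proj₂ x +_) (mass-++ xs ys)) (sym (+-assoc (proj₂ x) _ _))

  mass-uniform : ∀ (f : Node → List Node) q xs → mass (map (λ j → f j , q) xs) ≡ fromℕ (length xs) * q
  mass-uniform f q [] = sym (*-zeroˡ q)
  mass-uniform f q (x ∷ xs) = begin
    q + mass (map (λ j → f j , q) xs)     ≡⟨ cong (q +_) (mass-uniform f q xs) ⟩
    q + fromℕ (length xs) * q             ≡⟨ cong (_+ fromℕ (length xs) * q) (*-identityˡ q) ⟨
    1ℚ * q + fromℕ (length xs) * q        ≡⟨ *-distribʳ-+ q 1ℚ (fromℕ (length xs)) ⟨
    (1ℚ + fromℕ (length xs)) * q          ≡⟨ cong (_* q) (fromℕ-homo-+ 1 (length xs)) ⟨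
    fromℕ (suc (length xs)) * q           ∎
    where open ≡-Reasoning

  step-nonNegative : ∀ t {p} → 0ℚ ≤ p → NonNegative (step (t , p))
  step-nonNegative t {p} 0≤p with Smin t
  ... | [] = []
  ... | ss@(_ ∷ _) = map⁺ (All.universal (λ _ → 0≤p*share) ss)
    where
    0≤p*share : 0ℚ ≤ p * (ℤ.+ 1 / length ss)
    0≤p*share = nonNegative⁻¹ _ {{nonNeg*nonNeg⇒nonNeg p {{nonNegative 0≤p}} _ {{normalize-nonNeg 1 (length ss)}}}}

  mass-step : ∀ t {p} → 0ℚ ≤ p → mass (step (t , p)) ≤ p
  mass-step t {p} 0≤p with Smin t
  ... | [] = 0≤p
  ... | ss@(_ ∷ ss′) = ≤-reflexive (begin
    mass (map (λ j → (j ∷ t) , p * share) ss)   ≡⟨ mass-uniform (_∷ t) (p * share) ss ⟩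
    fromℕ (suc n) * (p * share)                  ≡⟨ cong (fromℕ (suc n) *_) (*-comm p share) ⟩
    fromℕ (suc n) * (share * p)                  ≡⟨ *-assoc (fromℕ (suc n)) share p ⟨
    fromℕ (suc n) * share * p                    ≡⟨ cong (_* p) (fromℕ-*-inverse n) ⟩
    1ℚ * p                                       ≡⟨ *-identityˡ p ⟩
    p                                            ∎)
    where
    open ≡-Reasoning
    n : ℕ
    n = length ss′
    share : ℚ
    share = ℤ.+ 1 / suc n

  concatMap-step-nonNegative : ∀ {d} → NonNegative d → NonNegative (concatMap step d)
  concatMap-step-nonNegative [] = []
  concatMap-step-nonNegative {(t , _) ∷ _} (0≤p ∷ nonNeg) =
    ++⁺ (step-nonNegative t 0≤p) (concatMap-step-nonNegative nonNeg)

  mass-concatMap-step : ∀ {d} → NonNegative d → mass (concatMap step d) ≤ mass d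
  mass-concatMap-step [] = ≤-refl
  mass-concatMap-step {(t , p) ∷ d} (0≤p ∷ nonNeg) =
    ≤-trans (≤-reflexive (mass-++ (step (t , p)) (concatMap step d)))
            (+-mono-≤ (mass-step t 0≤p) (mass-concatMap-step nonNeg))

  dist-nonNegative : ∀ m → NonNegative (dist m)
  dist-nonNegative zero = nonNegative⁻¹ 1ℚ ∷ []
  dist-nonNegative (suc m) = concatMap-step-nonNegative (dist-nonNegative m)

  mass-dist-≤1 : ∀ m → mass (dist m) ≤ 1ℚ
  mass-dist-≤1 zero = ≤-reflexive (+-identityʳ 1ℚ)
  mass-dist-≤1 (suc m) = ≤-trans (mass-concatMap-step (dist-nonNegative m)) (mass-dist-≤1 m)

  uncoveredMass-≤-mass : ∀ {d} → NonNegative d → uncoveredMass d ≤ mass d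
  uncoveredMass-≤-mass [] = ≤-refl
  uncoveredMass-≤-mass {(t , p) ∷ _} (0≤p ∷ nonNeg) = +-mono-≤ weight-≤ (uncoveredMass-≤-mass nonNeg)
    where
    weight-≤ : (if covered t then 0ℚ else p) ≤ p
    weight-≤ with covered t
    ... | true = 0≤p
    ... | false = ≤-refl

  uncoveredMass-covered : ∀ {d} → All (λ tp → T (covered (proj₁ tp))) d → uncoveredMass d ≡ 0ℚ
  uncoveredMass-covered [] = refl
  uncoveredMass-covered {(t , _) ∷ _} (t-covered ∷ rest) with covered t | t-covered
  ... | true | _ = trans (+-identityˡ _) (uncoveredMass-covered rest)
  ... | false | ()

  tailProb-≤1 : ∀ m → tailProb m ≤ 1ℚ
  tailProb-≤1 m = ≤-trans (uncoveredMass-≤-mass (dist-nonNegative m)) (mass-dist-≤1 m)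

  tailProb-vanishes : ∀ {m} → coverBound ℕ.≤ m → tailProb m ≡ 0ℚ
  tailProb-vanishes bound≤m = uncoveredMass-covered (All.tabulate (dist-covered bound≤m))

  partialExpectation-≤ : ∀ M → partialExpectation M ≤ fromℕ M
  partialExpectation-≤ zero = ≤-refl
  partialExpectation-≤ (suc M) = ≤-trans (+-mono-≤ (partialExpectation-≤ M) (tailProb-≤1 M))
    (≤-reflexive (trans (sym (fromℕ-homo-+ M 1)) (cong fromℕ (ℕ.+-comm M 1))))

  partialExpectation-stable : ∀ k → partialExpectation (k ℕ.+ coverBound) ≡ partialExpectation coverBound
  partialExpectation-stable zero = refl
  partialExpectation-stable (suc k) = begin
    partialExpectation (k ℕ.+ coverBound) + tailProb (k ℕ.+ coverBound)
      ≡⟨ cong (partialExpectation (k ℕ.+ coverBound) +_) (tailProb-vanishes (ℕ.m≤n+m coverBound k)) ⟩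
    partialExpectation (k ℕ.+ coverBound) + 0ℚ  ≡⟨ +-identityʳ _ ⟩
    partialExpectation (k ℕ.+ coverBound)       ≡⟨ partialExpectation-stable k ⟩
    partialExpectation coverBound               ∎
    where open ≡-Reasoning

  partialExpectation-bound : ∀ M → partialExpectation M ≤ fromℕ coverBound
  partialExpectation-bound M with M ≤? coverBound
  ... | yes M≤bound = ≤-trans (partialExpectation-≤ M) (fromℕ-mono-≤ M≤bound)
  ... | no M≰bound = begin
    partialExpectation M                               ≡⟨ cong partialExpectation (ℕ.m∸n+n≡m bound≤M) ⟨
    partialExpectation (M ∸ coverBound ℕ.+ coverBound) ≡⟨ partialExpectation-stable (M ∸ coverBound) ⟩
    partialExpectation coverBound                      ≤⟨ partialExpectation-≤ coverBound ⟩
    fromℕ coverBound                                   ∎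
    where
    open Data.Rational.Properties.≤-Reasoning
    bound≤M : coverBound ℕ.≤ M
    bound≤M = ℕ.<⇒≤ (ℕ.≰⇒> M≰bound)

module CoverArithmetic where
  open import Data.Nat using (ℕ; suc; _+_; _*_; _^_; _≤_; z≤n; s≤s)
  open import Data.Nat.Properties
  open import Data.Nat.Tactic.RingSolver using (solve-∀)
  open import Relation.Binary.PropositionalEquality using (_≡_; cong)

  cover-arithmetic : ∀ c h E →
    c * E ≤ suc c ^ suc h * suc (suc c) + c * suc c ^ suc h →
    c * suc (E * (suc h + suc h)) ≤ 4 * suc h * (suc c + 1) * suc c ^ suc h
  cover-arithmetic c h E cE≤ = begin
    c * suc (E * (H + H))          ≡⟨ *-suc c (E * (H + H)) ⟩
    c + c * (E * (H + H))          ≡⟨ cong (c +_) (*-assoc c E (H + H)) ⟨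
    c + c * E * (H + H)            ≤⟨ +-mono-≤ c≤4HX (*-monoˡ-≤ (H + H) cE≤) ⟩
    4 * H * X + (X * suc b + c * X) * (H + H)  ≡⟨ regroup c h X ⟩
    4 * H * (b + 1) * X            ∎
    where
    open ≤-Reasoning
    b H X : ℕ
    b = suc c
    H = suc h
    X = b ^ H
    regroup : ∀ c h X → 4 * suc h * X + (X * suc (suc c) + c * X) * (suc h + suc h) ≡ 4 * suc h * (suc c + 1) * X
    regroup = solve-∀
    c≤4HX : c ≤ 4 * H * X
    c≤4HX = begin
      c          ≤⟨ n≤1+n c ⟩
      b          ≡⟨ *-identityʳ b ⟨
      b ^ 1      ≤⟨ ^-monoʳ-≤ b {1} {H} (s≤s z≤n) ⟩
      X          ≤⟨ m≤n*m X (4 * H) ⟩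
      4 * H * X  ∎

open import Data.Nat using (ℕ; _≤_; _∸_; _^_)
open import Data.Integer using (+_)
open import Data.Rational using (_*_) renaming (_≤_ to _≤ℚ_; _/_ to _/ℚ_)
import Data.Nat as ℕ
import Data.Rational.Properties as ℚ
open NaturalsInRationals using (fromℕ; fromℕ-homo-*; fromℕ-mono-≤)
open CoverArithmetic using (cover-arithmetic)

theorem8 : (b H : ℕ) → 2 ≤ b → 1 ≤ H → (M : ℕ) →
    ((+ (b ∸ 1)) /ℚ 1) * Tree.partialExpectation b H M
      ≤ℚ ((+ (4 Data.Nat.* H Data.Nat.* (b Data.Nat.+ 1) Data.Nat.* b ^ H)) /ℚ 1)
theorem8 b@(ℕ.suc c) H@(ℕ.suc h) (ℕ.s≤s _) (ℕ.s≤s _) M = begin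
  fromℕ c * partialExpectation M
    ≤⟨ ℚ.*-monoˡ-≤-nonNeg (fromℕ c) {{ℚ.normalize-nonNeg c 1}} (partialExpectation-bound M) ⟩
  fromℕ c * fromℕ coverBound           ≡⟨ fromℕ-homo-* c coverBound ⟨
  fromℕ (c ℕ.* coverBound)             ≤⟨ fromℕ-mono-≤ (cover-arithmetic c h degreeSum degreeSum-bound) ⟩
  fromℕ (4 ℕ.* H ℕ.* (b ℕ.+ 1) ℕ.* b ^ H) ∎
  where
  open Tree b H using (partialExpectation)
  open Trajectories b H using (degreeSum; coverBound; degreeSum-bound)
  open TailSums b H using (partialExpectation-bound)
  open ℚ.≤-Reasoning
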